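{- Let $\mathcal M=(M,<,\ldots)$ be a uniformly locally weakly o-minimal structure of the second kind. Let $X$ be a definable subset of $M^n$ with nonempty interior and let $X=X_1\cup X_2$ be a partition of $X$ into two definable subsets. Then at least one of $X_1$ and $X_2$ has nonempty interior.
   Context: $\mathcal M$ is an expansion of a dense linear order without endpoints; "definable" means with parameters; $M^n$ carries the product of order topologies. For $X\subseteq M^{n+1}$ and $x\in M^n$, $X_x=\{y\in M:(x,y)\in X\}$. $\mathcal M$ is uniformly locally weakly o-minimal of the second kind if (a) for every definable $X\subseteq M$ and $a\in M$ there is an open interval $I\ni a$ with $X\cap I$ a union of a finite set and finitely many open convex sets, and (b) for every $n\ge1$, definable $X\subseteq M^{n+1}$, $a\in M$ and $b\in M^n$ there exist an open interval $I\ni a$ and an open box $B\ni b$ such that $X_x\cap I$ is a union of a finite set and finitely many open convex sets for all $x\in B$. -}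

module Defs where

open import Level using (0ℓ)
open import Data.Nat using (ℕ; suc)
open import Data.Fin using (Fin; zero; suc)
open import Data.Vec using (Vec; []; _∷_; _∷ʳ_; lookup; tabulate)
open import Data.List using (List)
open import Data.List.Membership.Propositional using (_∈_)
open import Data.Product using (Σ; ∃; _×_; _,_)
open import Data.Sum using (_⊎_)
open import Relation.Nullary using (¬_)
open import Relation.Binary.PropositionalEquality using (_≡_)
open import Relation.Binary.Structures using (IsStrictTotalOrder)
open import Relation.Unary using (Pred)
open import Function.Bundles using (_⇔_)

-- A dense linear order without endpoints, together with a "structure" on it
-- in the sense of van den Dries: for each n a collection Def n of subsets of
-- M^n (the definable sets, with parameters).  The closure conditions below are
-- satisfied by the parameter-definable sets of any expansion of (M,<), and
-- conversely any such system is the system of parameter-definable sets of the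
-- expansion of (M,<) by a predicate for each of its members.
record Structure : Set₁ where
  field
    M    : Set
    _<_  : M → M → Set
    isSTO     : IsStrictTotalOrder _≡_ _<_
    dense     : ∀ {a b} → a < b → ∃ λ c → (a < c) × (c < b)
    noLeftEnd  : ∀ a → ∃ λ b → b < a
    noRightEnd : ∀ a → ∃ λ b → a < b
    Def  : (n : ℕ) → Pred (Vec M n) 0ℓ → Set
    def-ext   : ∀ {n} {A B : Pred (Vec M n) 0ℓ} →
                (∀ v → A v ⇔ B v) → Def n A → Def n B
    def-compl : ∀ {n} {A : Pred (Vec M n) 0ℓ} → Def n A → Def n (λ v → ¬ A v)
    def-inter : ∀ {n} {A B : Pred (Vec M n) 0ℓ} → Def n A → Def n B →
                Def n (λ v → A v × B v)
    def-union : ∀ {n} {A B : Pred (Vec M n) 0ℓ} → Def n A → Def n B →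
                Def n (λ v → A v ⊎ B v)
    -- reindexing of coordinates along any map Fin m → Fin n
    -- (covers products with M, permutations, diagonals)
    def-reindex : ∀ {m n} (f : Fin m → Fin n) {A : Pred (Vec M m) 0ℓ} →
                  Def m A → Def n (λ v → A (tabulate (λ i → lookup v (f i))))
    def-proj  : ∀ {n} {A : Pred (Vec M (suc n)) 0ℓ} →
                Def (suc n) A → Def n (λ v → ∃ λ y → A (v ∷ʳ y))
    def-eq    : Def 2 (λ v → lookup v zero ≡ lookup v (suc zero))
    def-lt    : Def 2 (λ v → lookup v zero < lookup v (suc zero))
    def-const : ∀ (c : M) → Def 1 (λ v → lookup v zero ≡ c)

module _ (𝓜 : Structure) where
  open Structure 𝓜

  InInterval : M → M → M → Set
  InInterval l u y = (l < y) × (y < u)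

  InBox : ∀ {n} → Vec M n → Vec M n → Vec M n → Set
  InBox lo hi v = ∀ i → (lookup lo i < lookup v i) × (lookup v i < lookup hi i)

  IsBox : ∀ {n} → Vec M n → Vec M n → Set
  IsBox lo hi = ∀ i → lookup lo i < lookup hi i

  HasNonemptyInterior : ∀ {n} → Pred (Vec M n) 0ℓ → Set
  HasNonemptyInterior X =
    Σ (Vec M _) λ lo → Σ (Vec M _) λ hi →
      IsBox lo hi × (∀ v → InBox lo hi v → X v)

  Convex : Pred M 0ℓ → Set
  Convex C = ∀ {x y z} → C x → C z → x < y → y < z → C y

  OpenSet : Pred M 0ℓ → Set
  OpenSet C = ∀ {x} → C x → ∃ λ l → ∃ λ u →
    (l < x) × (x < u) × (∀ y → InInterval l u y → C y)

  FinitePlusOpenConvex : Pred M 0ℓ → Set₁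
  FinitePlusOpenConvex S =
    Σ (List M) λ F → Σ ℕ λ k → Σ (Fin k → Pred M 0ℓ) λ C →
      (∀ i → OpenSet (C i) × Convex (C i)) ×
      (∀ y → S y ⇔ ((y ∈ F) ⊎ (∃ λ i → C i y)))

  Fibre : ∀ {n} → Pred (Vec M (suc n)) 0ℓ → Vec M n → Pred M 0ℓ
  Fibre X x y = X (x ∷ʳ y)

  record UniformlyLocallyWeaklyOMinimal2 : Set₁ where
    field
      condA : ∀ (X : Pred M 0ℓ) → Def 1 (λ v → X (lookup v zero)) → ∀ a →
        ∃ λ l → ∃ λ u → (l < a) × (a < u) ×
          FinitePlusOpenConvex (λ y → X y × InInterval l u y)
      condB : ∀ (n : ℕ) (X : Pred (Vec M (suc (suc n))) 0ℓ) →
        Def (suc (suc n)) X → ∀ (a : M) (b : Vec M (suc n)) →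
        ∃ λ l → ∃ λ u → Σ (Vec M (suc n)) λ lo → Σ (Vec M (suc n)) λ hi →
          (l < a) × (a < u) × InBox lo hi b ×
          (∀ x → InBox lo hi x →
             FinitePlusOpenConvex (λ y → Fibre X x y × InInterval l u y))

-- By simultaneous induction on n, for definable sets and boxes B in Mⁿ:
--   Dichotomy: B has a subbox inside Z or inside its complement;
--   UniformWitness: if Q ⊆ Mⁿ⁺¹ is downward closed in the last coordinate above c and each
--   x ∈ B has some y ∈ (c , d) with Q (x , y), then one such y works on a subbox of B.
-- The theorem is Dichotomy for X₁ inside a box contained in X.
--
-- Dichotomy (n + 1): near the centre of B, condition (b) makes all but finitely many points of
-- each fibre of Z and of its complement interior, so for every x an initial piece (l₀ , y) of
-- the last side consists of interior points of Z_x or of its complement.  UniformWitness makes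
-- y uniform, Dichotomy n decides the alternative at one point y₂ of (l₀ , y) on a subbox, and
-- UniformWitness again gives a uniform interval above y₂.
-- UniformWitness (n + 1): apply Dichotomy (n + 1) to the set of (x , k) for which a single y
-- works for all k′ near k.  On a subbox inside this set UniformWitness n applies.  A subbox
-- avoiding it is impossible, by an argument on one line {x} × (p , q): the fibres
-- {k : Q (x , k , y)} would be finite near the midpoint x₀, so the least points above x₀ of
-- these fibres form a definable set with an interior point, and the y of that point works on
-- an interval.

module Submission where

open import Defs
open import Level using (0ℓ; Lift; lift; lower) renaming (suc to lsuc)
open import Data.Nat using (ℕ; zero; suc; _+_)
open import Data.Fin using (Fin; zero; suc; fromℕ; inject₁; #_)
open import Data.Vec using (Vec; []; _∷_; _∷ʳ_; lookup; tabulate; map; zipWith; initLast; init; last)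
open import Data.Vec.Properties
  using (init-∷ʳ; last-∷ʳ; map-∷ʳ; tabulate-∘; tabulate-cong; tabulate∘lookup; lookup∘tabulate; lookup-zipWith)
open import Data.List using (List; []; _∷_)
open import Data.List.Membership.Propositional using (_∈_)
open import Data.List.Relation.Unary.Any using (here; there)
open import Data.Product using (Σ; ∃; _×_; _,_; proj₁; proj₂; map₁)
open import Data.Sum using (_⊎_; inj₁; inj₂; [_,_]′) renaming (map to map-⊎)
open import Data.Empty using (⊥; ⊥-elim)
open import Relation.Nullary using (¬_; yes; no)
open import Relation.Nullary.Decidable using (map′)
open import Relation.Unary using (Pred; ∁)
open import Relation.Binary.PropositionalEquality
  using (_≡_; refl; sym; trans; cong; cong₂; subst; subst₂; module ≡-Reasoning)
open import Relation.Binary.Structures using (IsStrictTotalOrder)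
open import Relation.Binary.Definitions using (tri<; tri≈; tri>)
open import Function.Bundles using (_⇔_; mk⇔; Equivalence)
open import Function using (_∘_; id; case_of_)
open import Axiom.ExcludedMiddle using (ExcludedMiddle)
open import Axiom.DoubleNegationElimination using (DoubleNegationElimination; em⇒dne)

open Structure using (M; Def)
open Equivalence using (to; from)

module Classical (lem : ExcludedMiddle (lsuc 0ℓ)) where

  em : ExcludedMiddle 0ℓ
  em {P} = map′ lower lift (lem {Lift (lsuc 0ℓ) P})

  dne : DoubleNegationElimination 0ℓ
  dne = em⇒dne em

module StrictTotalOrderLemmas {A : Set} {_<_ : A → A → Set} (sto : IsStrictTotalOrder _≡_ _<_) where
  open IsStrictTotalOrder sto using (compare; irrefl; asym) renaming (trans to <-trans)

  <-irrefl : ∀ {a} → ¬ (a < a)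
  <-irrefl = irrefl refl

  ≮-<-trans : ∀ {a b c} → ¬ (b < a) → b < c → a < c
  ≮-<-trans {a} {b} b≮a b<c with compare a b
  ... | tri< a<b _ _ = <-trans a<b b<c
  ... | tri≈ _ refl _ = b<c
  ... | tri> _ _ b<a = ⊥-elim (b≮a b<a)

  infixl 30 _⊓_ _⊔_

  _⊓_ : A → A → A
  a ⊓ b with compare a b
  ... | tri< _ _ _ = a
  ... | tri≈ _ _ _ = a
  ... | tri> _ _ _ = b

  _⊔_ : A → A → A
  a ⊔ b with compare a b
  ... | tri< _ _ _ = b
  ... | tri≈ _ _ _ = b
  ... | tri> _ _ _ = a

  <-⊓ : ∀ {a b z} → z < a → z < b → z < a ⊓ b
  <-⊓ {a} {b} z<a z<b with compare a b
  ... | tri< _ _ _ = z<a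
  ... | tri≈ _ _ _ = z<a
  ... | tri> _ _ _ = z<b

  <-⊓⁻ : ∀ {a b z} → z < a ⊓ b → (z < a) × (z < b)
  <-⊓⁻ {a} {b} z<m with compare a b
  ... | tri< a<b _ _ = z<m , <-trans z<m a<b
  ... | tri≈ _ refl _ = z<m , z<m
  ... | tri> _ _ b<a = <-trans z<m b<a , z<m

  ⊔-< : ∀ {a b z} → a < z → b < z → a ⊔ b < z
  ⊔-< {a} {b} a<z b<z with compare a b
  ... | tri< _ _ _ = b<z
  ... | tri≈ _ _ _ = b<z
  ... | tri> _ _ _ = a<z

  ⊔-<⁻ : ∀ {a b z} → a ⊔ b < z → (a < z) × (b < z)
  ⊔-<⁻ {a} {b} m<z with compare a b
  ... | tri< a<b _ _ = <-trans a<b m<z , m<z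
  ... | tri≈ _ refl _ = m<z , m<z
  ... | tri> _ _ b<a = m<z , <-trans b<a m<z

init∷ʳlast : ∀ {A : Set} {m} (c : Vec A (suc m)) → c ≡ init c ∷ʳ last c
init∷ʳlast c = proj₂ (proj₂ (initLast c))

lookup-∷ʳ-inject₁ : ∀ {A : Set} {m} (v : Vec A m) y (i : Fin m) → lookup (v ∷ʳ y) (inject₁ i) ≡ lookup v i
lookup-∷ʳ-inject₁ (a ∷ v) y zero = refl
lookup-∷ʳ-inject₁ (a ∷ v) y (suc i) = lookup-∷ʳ-inject₁ v y i

lookup-∷ʳ-last : ∀ {A : Set} {m} (v : Vec A m) y → lookup (v ∷ʳ y) (fromℕ m) ≡ y
lookup-∷ʳ-last [] y = refl
lookup-∷ʳ-last (a ∷ v) y = lookup-∷ʳ-last v y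

module Formulas (lem : ExcludedMiddle (lsuc 0ℓ)) (𝓜 : Structure) where
  open Structure 𝓜 renaming (M to 𝕄; Def to Definable)
  open Classical lem

  infixl 5 _▷_
  infixl 5 _⧺_

  data Snoc (A : Set) : ℕ → Set where
    ε : Snoc A 0
    _▷_ : ∀ {k} → Snoc A k → A → Snoc A (suc k)

  lookupˢ : ∀ {A : Set} {k} → Snoc A k → Fin k → A
  lookupˢ (ρ ▷ y) zero = y
  lookupˢ (ρ ▷ y) (suc i) = lookupˢ ρ i

  mapˢ : ∀ {A B : Set} {k} → (A → B) → Snoc A k → Snoc B k
  mapˢ f ε = ε
  mapˢ f (ρ ▷ y) = mapˢ f ρ ▷ f y

  _⧺_ : ∀ {A : Set} {n k} → Vec A n → Snoc A k → Vec A (k + n)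
  x ⧺ ε = x
  x ⧺ (ρ ▷ y) = (x ⧺ ρ) ∷ʳ y

  front : ∀ {n} k → Vec 𝕄 (k + n) → Vec 𝕄 n
  front zero c = c
  front (suc k) c = front k (init c)

  back : ∀ {n} k → Vec 𝕄 (k + n) → Snoc 𝕄 k
  back zero c = ε
  back (suc k) c = back k (init c) ▷ last c

  front-⧺ : ∀ {n k} (x : Vec 𝕄 n) (ρ : Snoc 𝕄 k) → front k (x ⧺ ρ) ≡ x
  front-⧺ x ε = refl
  front-⧺ x (ρ ▷ y) rewrite init-∷ʳ y (x ⧺ ρ) = front-⧺ x ρ

  back-⧺ : ∀ {n k} (x : Vec 𝕄 n) (ρ : Snoc 𝕄 k) → back k (x ⧺ ρ) ≡ ρ
  back-⧺ x ε = refl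
  back-⧺ x (ρ ▷ y) rewrite init-∷ʳ y (x ⧺ ρ) | last-∷ʳ y (x ⧺ ρ) = cong (_▷ y) (back-⧺ x ρ)

  front⧺back : ∀ {n} k (c : Vec 𝕄 (k + n)) → front k c ⧺ back k c ≡ c
  front⧺back zero c = refl
  front⧺back (suc k) c = trans (cong (_∷ʳ last c) (front⧺back k (init c))) (sym (init∷ʳlast c))

  map-⧺ : ∀ {A B : Set} {n k} (f : A → B) (x : Vec A n) (ρ : Snoc A k) → map f (x ⧺ ρ) ≡ map f x ⧺ mapˢ f ρ
  map-⧺ f x ε = refl
  map-⧺ f x (ρ ▷ y) = trans (map-∷ʳ f y (x ⧺ ρ)) (cong (_∷ʳ f y) (map-⧺ f x ρ))

  -- positions in x ⧺ ρ of the entries of ρ and of x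
  backPos : ∀ {n k} → Fin k → Fin (k + n)
  backPos {n} {suc k} zero = fromℕ (k + n)
  backPos {n} {suc k} (suc i) = inject₁ (backPos {n} {k} i)

  frontPos : ∀ {n} k → Fin n → Fin (k + n)
  frontPos zero b = b
  frontPos (suc k) b = inject₁ (frontPos k b)

  lookup-backPos : ∀ {n k} (x : Vec 𝕄 n) (ρ : Snoc 𝕄 k) i → lookup (x ⧺ ρ) (backPos {n} {k} i) ≡ lookupˢ ρ i
  lookup-backPos x (ρ ▷ y) zero = lookup-∷ʳ-last (x ⧺ ρ) y
  lookup-backPos x (ρ ▷ y) (suc i) = trans (lookup-∷ʳ-inject₁ (x ⧺ ρ) y (backPos i)) (lookup-backPos x ρ i)

  lookup-frontPos : ∀ {n k} (x : Vec 𝕄 n) (ρ : Snoc 𝕄 k) b → lookup (x ⧺ ρ) (frontPos k b) ≡ lookup x b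
  lookup-frontPos x ε b = refl
  lookup-frontPos x (ρ ▷ y) b = trans (lookup-∷ʳ-inject₁ (x ⧺ ρ) y (frontPos _ b)) (lookup-frontPos x ρ b)

  -- Variables are de Bruijn indices into a snoc-list ρ of k values; the atom rel A _ vs holds
  -- when A contains the fixed prefix x followed by the values of the variables vs.
  data Term (k : ℕ) : Set where
    var : Fin k → Term k
    cst : 𝕄 → Term k

  data Formula (n : ℕ) : ℕ → Set₁ where
    rel : ∀ {k j} (A : Pred (Vec 𝕄 (j + n)) 0ℓ) → Definable (j + n) A → Snoc (Fin k) j → Formula n k
    _<ᶠ_ : ∀ {k} → Term k → Term k → Formula n k
    ¬ᶠ_ : ∀ {k} → Formula n k → Formula n k
    _∧ᶠ_ _∨ᶠ_ _⇒ᶠ_ : ∀ {k} → Formula n k → Formula n k → Formula n k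
    ∃ᶠ ∀ᶠ : ∀ {k} → Formula n (suc k) → Formula n k

  infix 7 _<ᶠ_
  infix 6 ¬ᶠ_
  infixr 5 _∧ᶠ_ _∨ᶠ_
  infixr 4 _⇒ᶠ_

  ⟦_⟧ᵗ : ∀ {k} → Term k → Snoc 𝕄 k → 𝕄
  ⟦ var i ⟧ᵗ ρ = lookupˢ ρ i
  ⟦ cst a ⟧ᵗ ρ = a

  ⟦_⟧ : ∀ {n k} → Formula n k → Vec 𝕄 n → Snoc 𝕄 k → Set
  ⟦ rel A _ vs ⟧ x ρ = A (x ⧺ mapˢ (lookupˢ ρ) vs)
  ⟦ s <ᶠ t ⟧ x ρ = ⟦ s ⟧ᵗ ρ < ⟦ t ⟧ᵗ ρ
  ⟦ ¬ᶠ φ ⟧ x ρ = ¬ ⟦ φ ⟧ x ρ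
  ⟦ φ ∧ᶠ ψ ⟧ x ρ = ⟦ φ ⟧ x ρ × ⟦ ψ ⟧ x ρ
  ⟦ φ ∨ᶠ ψ ⟧ x ρ = ⟦ φ ⟧ x ρ ⊎ ⟦ ψ ⟧ x ρ
  ⟦ φ ⇒ᶠ ψ ⟧ x ρ = ⟦ φ ⟧ x ρ → ⟦ ψ ⟧ x ρ
  ⟦ ∃ᶠ φ ⟧ x ρ = Σ 𝕄 λ y → ⟦ φ ⟧ x (ρ ▷ y)
  ⟦ ∀ᶠ φ ⟧ x ρ = (y : 𝕄) → ⟦ φ ⟧ x (ρ ▷ y)

  weaken : ∀ {k} → Term k → Term (suc k)
  weaken (var i) = var (suc i)
  weaken (cst a) = cst a

  infixr 3 ∀⟨_,_⟩_ ∃⟨_,_⟩_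

  ∀⟨_,_⟩_ : ∀ {n k} → Term k → Term k → Formula n (suc k) → Formula n k
  ∀⟨ s , t ⟩ φ = ∀ᶠ (weaken s <ᶠ var (# 0) ⇒ᶠ var (# 0) <ᶠ weaken t ⇒ᶠ φ)

  ∃⟨_,_⟩_ : ∀ {n k} → Term k → Term k → Formula n (suc k) → Formula n k
  ∃⟨ s , t ⟩ φ = ∃ᶠ (weaken s <ᶠ var (# 0) ∧ᶠ var (# 0) <ᶠ weaken t ∧ᶠ φ)

  -- φ holds on an open interval around c; inside φ the point of the interval is var (# 0)
  interiorᶠ : ∀ {n k} → Term k → Formula n (suc (suc (suc k))) → Formula n k
  interiorᶠ c φ = ∃ᶠ (∃ᶠ (var (# 1) <ᶠ c″ ∧ᶠ c″ <ᶠ var (# 0) ∧ᶠ (∀⟨ var (# 1) , var (# 0) ⟩ φ)))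
    where c″ = weaken (weaken c)

  pair : ∀ {m} → Fin m → Fin m → Fin 2 → Fin m
  pair i j zero = i
  pair i j (suc _) = j

  definable-≡const : ∀ m (i : Fin m) a → Definable m (λ c → lookup c i ≡ a)
  definable-≡const m i a = def-reindex (λ _ → i) (def-const a)

  definable-< : ∀ m (i j : Fin m) → Definable m (λ c → lookup c i < lookup c j)
  definable-< m i j = def-reindex (pair i j) def-lt

  -- comparisons with a constant a: put a in a fresh last coordinate and project it away
  definable-<const : ∀ m (i : Fin m) a → Definable m (λ c → lookup c i < a)
  definable-<const m i a =
    def-ext eqv (def-proj (def-inter (definable-≡const (suc m) (fromℕ m) a) (definable-< (suc m) (inject₁ i) (fromℕ m))))
    where
      eqv : ∀ v → (∃ λ y → (lookup (v ∷ʳ y) (fromℕ m) ≡ a) × (lookup (v ∷ʳ y) (inject₁ i) < lookup (v ∷ʳ y) (fromℕ m)))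
                  ⇔ (lookup v i < a)
      eqv v = mk⇔ (λ { (y , e , l) → subst₂ _<_ (lookup-∷ʳ-inject₁ v y i) e l })
                  (λ h → a , lookup-∷ʳ-last v a , subst₂ _<_ (sym (lookup-∷ʳ-inject₁ v a i)) (sym (lookup-∷ʳ-last v a)) h)

  definable-const< : ∀ m a (i : Fin m) → Definable m (λ c → a < lookup c i)
  definable-const< m a i =
    def-ext eqv (def-proj (def-inter (definable-≡const (suc m) (fromℕ m) a) (definable-< (suc m) (fromℕ m) (inject₁ i))))
    where
      eqv : ∀ v → (∃ λ y → (lookup (v ∷ʳ y) (fromℕ m) ≡ a) × (lookup (v ∷ʳ y) (fromℕ m) < lookup (v ∷ʳ y) (inject₁ i)))
                  ⇔ (a < lookup v i)
      eqv v = mk⇔ (λ { (y , e , l) → subst₂ _<_ e (lookup-∷ʳ-inject₁ v y i) l })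
                  (λ h → a , lookup-∷ʳ-last v a , subst₂ _<_ (sym (lookup-∷ʳ-last v a)) (sym (lookup-∷ʳ-inject₁ v a i)) h)

  definable-const<const : ∀ m a b → Definable m (λ c → a < b)
  definable-const<const m a b =
    def-ext eqv (def-proj (def-inter (definable-≡const (suc m) (fromℕ m) a) (definable-<const (suc m) (fromℕ m) b)))
    where
      eqv : ∀ v → (∃ λ y → (lookup (v ∷ʳ y) (fromℕ m) ≡ a) × (lookup (v ∷ʳ y) (fromℕ m) < b)) ⇔ (a < b)
      eqv v = mk⇔ (λ { (y , e , l) → subst (_< b) e l })
                  (λ h → a , lookup-∷ʳ-last v a , subst (_< b) (sym (lookup-∷ʳ-last v a)) h)

  definable-split : ∀ {n k} {D : Pred (Vec 𝕄 (k + n)) 0ℓ} → Definable (k + n) D →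
                    (S : Vec 𝕄 n → Snoc 𝕄 k → Set) →
                    (∀ x ρ → D (x ⧺ ρ) ⇔ S x ρ) → Definable (k + n) (λ c → S (front k c) (back k c))
  definable-split {n} {k} {D} dD S D⇔S =
    def-ext (λ c → mk⇔ (λ d → to (D⇔S _ _) (subst D (sym (front⧺back k c)) d))
                        (λ s → subst D (front⧺back k c) (from (D⇔S _ _) s))) dD

  tabulate-rel : ∀ {n k j} (x : Vec 𝕄 n) (ρ : Snoc 𝕄 k) (vs : Snoc (Fin k) j) →
                 tabulate (λ i → lookup (x ⧺ ρ) (lookup (tabulate (frontPos k) ⧺ mapˢ backPos vs) i))
                 ≡ x ⧺ mapˢ (lookupˢ ρ) vs
  tabulate-rel {n} {k} x ρ vs = begin
      tabulate (f ∘ lookup pos)                  ≡⟨ tabulate-∘ f (lookup pos) ⟩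
      map f (tabulate (lookup pos))              ≡⟨ cong (map f) (tabulate∘lookup pos) ⟩
      map f pos                                  ≡⟨ map-⧺ f (tabulate (frontPos k)) (mapˢ backPos vs) ⟩
      map f (tabulate (frontPos k)) ⧺ mapˢ f (mapˢ backPos vs)
        ≡⟨ cong₂ _⧺_ map-front (map-back vs) ⟩
      x ⧺ mapˢ (lookupˢ ρ) vs                    ∎
    where
      open ≡-Reasoning
      f = lookup (x ⧺ ρ)
      pos = tabulate (frontPos k) ⧺ mapˢ (backPos {n}) vs
      map-front : map f (tabulate (frontPos k)) ≡ x
      map-front = trans (sym (tabulate-∘ f (frontPos k))) (trans (tabulate-cong (lookup-frontPos x ρ)) (tabulate∘lookup x))
      map-back : ∀ {j} (ws : Snoc (Fin k) j) → mapˢ f (mapˢ (backPos {n}) ws) ≡ mapˢ (lookupˢ ρ) ws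
      map-back ε = refl
      map-back (ws ▷ w) = cong₂ _▷_ (map-back ws) (lookup-backPos x ρ w)

  -- The set of a formula is kept abstract so that its (large) normal form is never unfolded.
  abstract
    ⟦_⟧ˢ : ∀ {n k} → Formula n k → Pred (Vec 𝕄 (k + n)) 0ℓ
    ⟦_⟧ˢ {k = k} φ c = ⟦ φ ⟧ (front k c) (back k c)

    ⟦⟧ˢ-intro : ∀ {n k} (φ : Formula n k) {x ρ} → ⟦ φ ⟧ x ρ → ⟦ φ ⟧ˢ (x ⧺ ρ)
    ⟦⟧ˢ-intro φ {x} {ρ} = subst₂ ⟦ φ ⟧ (sym (front-⧺ x ρ)) (sym (back-⧺ x ρ))

    ⟦⟧ˢ-elim : ∀ {n k} (φ : Formula n k) {x ρ} → ⟦ φ ⟧ˢ (x ⧺ ρ) → ⟦ φ ⟧ x ρ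
    ⟦⟧ˢ-elim φ {x} {ρ} = subst₂ ⟦ φ ⟧ (front-⧺ x ρ) (back-⧺ x ρ)

    ⟦⟧ˢ-∷ʳ : ∀ {n k} (φ : Formula n (suc k)) v y → ⟦ φ ⟧ˢ (v ∷ʳ y) ⇔ ⟦ φ ⟧ (front k v) (back k v ▷ y)
    ⟦⟧ˢ-∷ʳ {n} {k} φ v y =
      mk⇔ (subst₂ S (init-∷ʳ y v) (last-∷ʳ y v)) (subst₂ S (sym (init-∷ʳ y v)) (sym (last-∷ʳ y v)))
      where
        S : Vec 𝕄 (k + n) → 𝕄 → Set
        S a b = ⟦ φ ⟧ (front k a) (back k a ▷ b)

    definable-<ᶠ : ∀ {n k} (s t : Term k) → Definable (k + n) (⟦_⟧ˢ {n} (s <ᶠ t))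
    definable-<ᶠ {n} {k} (var i) (var j) =
      definable-split (definable-< _ (backPos {n} i) (backPos {n} j)) _
        (λ x ρ → mk⇔ (subst₂ _<_ (lookup-backPos x ρ i) (lookup-backPos x ρ j))
                     (subst₂ _<_ (sym (lookup-backPos x ρ i)) (sym (lookup-backPos x ρ j))))
    definable-<ᶠ {n} {k} (var i) (cst a) =
      definable-split (definable-<const _ (backPos {n} i) a) _
        (λ x ρ → mk⇔ (subst (_< a) (lookup-backPos x ρ i)) (subst (_< a) (sym (lookup-backPos x ρ i))))
    definable-<ᶠ {n} {k} (cst a) (var i) =
      definable-split (definable-const< _ a (backPos {n} i)) _
        (λ x ρ → mk⇔ (subst (a <_) (lookup-backPos x ρ i)) (subst (a <_) (sym (lookup-backPos x ρ i))))
    definable-<ᶠ (cst a) (cst b) = definable-const<const _ a b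

    definable-formula : ∀ {n k} (φ : Formula n k) → Definable (k + n) ⟦ φ ⟧ˢ
    definable-formula {n} {k} (rel A dA vs) =
      definable-split (def-reindex (lookup (tabulate (frontPos k) ⧺ mapˢ backPos vs)) dA) _
        (λ x ρ → mk⇔ (subst A (tabulate-rel x ρ vs)) (subst A (sym (tabulate-rel x ρ vs))))
    definable-formula (s <ᶠ t) = definable-<ᶠ s t
    definable-formula (¬ᶠ φ) = def-compl (definable-formula φ)
    definable-formula (φ ∧ᶠ ψ) = def-inter (definable-formula φ) (definable-formula ψ)
    definable-formula (φ ∨ᶠ ψ) = def-union (definable-formula φ) (definable-formula ψ)
    definable-formula (φ ⇒ᶠ ψ) =
      def-ext (λ c → mk⇔ (λ { (inj₁ ¬a) a → ⊥-elim (¬a a) ; (inj₂ b) _ → b }) (implication c))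
              (def-union (def-compl (definable-formula φ)) (definable-formula ψ))
      where
        implication : ∀ c → (⟦ φ ⟧ˢ c → ⟦ ψ ⟧ˢ c) → ¬ ⟦ φ ⟧ˢ c ⊎ ⟦ ψ ⟧ˢ c
        implication c f with em {⟦ φ ⟧ˢ c}
        ... | yes a = inj₂ (f a)
        ... | no ¬a = inj₁ ¬a
    definable-formula (∃ᶠ φ) =
      def-ext (λ v → mk⇔ (λ { (y , h) → y , to (⟦⟧ˢ-∷ʳ φ v y) h })
                         (λ { (y , h) → y , from (⟦⟧ˢ-∷ʳ φ v y) h }))
              (def-proj (definable-formula φ))
    definable-formula (∀ᶠ φ) =
      def-ext (λ v → mk⇔ (λ ¬∃ y → dne λ ¬h → ¬∃ (y , λ h → ¬h (to (⟦⟧ˢ-∷ʳ φ v y) h)))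
                         (λ h → λ { (y , ¬h) → ¬h (from (⟦⟧ˢ-∷ʳ φ v y) (h y)) }))
              (def-compl (def-proj (def-compl (definable-formula φ))))

  definable-section : ∀ {n} {Q : Pred (Vec 𝕄 (suc n)) 0ℓ} → Definable (suc n) Q →
                      ∀ a → Definable n (λ v → Q (v ∷ʳ a))
  definable-section {n} {Q} dQ a = def-ext section (def-proj (def-inter dQ (definable-≡const (suc n) (fromℕ n) a)))
    where
      section : ∀ v → (∃ λ y → Q (v ∷ʳ y) × (lookup (v ∷ʳ y) (fromℕ n) ≡ a)) ⇔ Q (v ∷ʳ a)
      section v = mk⇔ (λ { (y , Qy , y≡a) → subst (λ w → Q (v ∷ʳ w)) (trans (sym (lookup-∷ʳ-last v y)) y≡a) Qy })
                      (λ Qa → a , Qa , lookup-∷ʳ-last v a)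

module Boxes (𝓜 : Structure) where
  open Structure 𝓜 renaming (M to 𝕄)
  open IsStrictTotalOrder isSTO using () renaming (trans to <-trans)
  open StrictTotalOrderLemmas isSTO

  record Box (n : ℕ) : Set where
    constructor box
    field
      lo hi : Vec 𝕄 n
      nonempty : IsBox 𝓜 lo hi

  open Box

  infix 4 _∈ᵇ_ _⊆ᵇ_

  record _∈ᵇ_ {n} (v : Vec 𝕄 n) (B : Box n) : Set where
    constructor inBox
    field bounds : InBox 𝓜 (lo B) (hi B) v

  open _∈ᵇ_

  _⊆ᵇ_ : ∀ {n} → Box n → Box n → Set
  B′ ⊆ᵇ B = ∀ {v} → v ∈ᵇ B′ → v ∈ᵇ B

  SubBox : ∀ {n} → Box n → Pred (Vec 𝕄 n) 0ℓ → Set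
  SubBox {n} B Z = Σ (Box n) λ B′ → B′ ⊆ᵇ B × (∀ v → v ∈ᵇ B′ → Z v)

  SubBox-⊆ : ∀ {n} {B B′ : Box n} {Z} → B′ ⊆ᵇ B → SubBox B′ Z → SubBox B Z
  SubBox-⊆ B′⊆B (B″ , B″⊆B′ , B″⊆Z) = B″ , B′⊆B ∘ B″⊆B′ , B″⊆Z

  ⊆ᵇ-refl : ∀ {n} {B : Box n} → B ⊆ᵇ B
  ⊆ᵇ-refl v∈ = v∈

  SubBox-map : ∀ {n} {B : Box n} {Z Z′ : Pred (Vec 𝕄 n) 0ℓ} →
               (∀ v → v ∈ᵇ B → Z v → Z′ v) → SubBox B Z → SubBox B Z′
  SubBox-map Z⇒Z′ (B′ , B′⊆B , Z-on) = B′ , B′⊆B , λ v v∈ → Z⇒Z′ v (B′⊆B v∈) (Z-on v v∈)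

  SubBox⇒interior : ∀ {n} {B : Box n} {Z} → SubBox B Z → HasNonemptyInterior 𝓜 Z
  SubBox⇒interior (box lo hi lo<hi , _ , Z-on) = lo , hi , lo<hi , λ v v∈ → Z-on v (inBox v∈)

  interior⇒box : ∀ {n} {X : Pred (Vec 𝕄 n) 0ℓ} → HasNonemptyInterior 𝓜 X →
                 Σ (Box n) λ B → ∀ v → v ∈ᵇ B → X v
  interior⇒box (lo , hi , lo<hi , X-on) = box lo hi lo<hi , λ v v∈ → X-on v (bounds v∈)

  private
    isBox-∷ʳ : ∀ {n} (lo hi : Vec 𝕄 n) {l u} → IsBox 𝓜 lo hi → l < u → IsBox 𝓜 (lo ∷ʳ l) (hi ∷ʳ u)
    isBox-∷ʳ [] [] _ l<u zero = l<u
    isBox-∷ʳ (_ ∷ lo) (_ ∷ hi) h l<u zero = h zero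
    isBox-∷ʳ (_ ∷ lo) (_ ∷ hi) h l<u (suc i) = isBox-∷ʳ lo hi (h ∘ suc) l<u i

    isBox-∷ʳ⁻ : ∀ {n} (lo hi : Vec 𝕄 n) {l u} → IsBox 𝓜 (lo ∷ʳ l) (hi ∷ʳ u) → IsBox 𝓜 lo hi × (l < u)
    isBox-∷ʳ⁻ [] [] h = (λ ()) , h zero
    isBox-∷ʳ⁻ (_ ∷ lo) (_ ∷ hi) h =
      let (rest , l<u) = isBox-∷ʳ⁻ lo hi (h ∘ suc) in (λ { zero → h zero ; (suc i) → rest i }) , l<u

    isBox-init-last : ∀ {n} (lo hi : Vec 𝕄 (suc n)) → IsBox 𝓜 lo hi → IsBox 𝓜 (init lo) (init hi) × (last lo < last hi)
    isBox-init-last lo hi h = isBox-∷ʳ⁻ (init lo) (init hi) (subst₂ (IsBox 𝓜) (init∷ʳlast lo) (init∷ʳlast hi) h)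

    inBox-∷ʳ : ∀ {n} (lo hi x : Vec 𝕄 n) {l u y} → InBox 𝓜 lo hi x → l < y → y < u →
               InBox 𝓜 (lo ∷ʳ l) (hi ∷ʳ u) (x ∷ʳ y)
    inBox-∷ʳ [] [] [] _ l<y y<u zero = l<y , y<u
    inBox-∷ʳ (_ ∷ lo) (_ ∷ hi) (_ ∷ x) h l<y y<u zero = h zero
    inBox-∷ʳ (_ ∷ lo) (_ ∷ hi) (_ ∷ x) h l<y y<u (suc i) = inBox-∷ʳ lo hi x (h ∘ suc) l<y y<u i

    inBox-∷ʳ⁻ : ∀ {n} (lo hi x : Vec 𝕄 n) {l u y} → InBox 𝓜 (lo ∷ʳ l) (hi ∷ʳ u) (x ∷ʳ y) →
                InBox 𝓜 lo hi x × (l < y) × (y < u)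
    inBox-∷ʳ⁻ [] [] [] h = (λ ()) , h zero
    inBox-∷ʳ⁻ (_ ∷ lo) (_ ∷ hi) (_ ∷ x) h =
      let (rest , l<y , y<u) = inBox-∷ʳ⁻ lo hi x (h ∘ suc) in (λ { zero → h zero ; (suc i) → rest i }) , l<y , y<u

  base : ∀ {n} → Box (suc n) → Box n
  base (box lo hi h) = box (init lo) (init hi) (proj₁ (isBox-init-last lo hi h))

  lastLo lastHi : ∀ {n} → Box (suc n) → 𝕄
  lastLo B = last (lo B)
  lastHi B = last (hi B)

  lastLo<lastHi : ∀ {n} (B : Box (suc n)) → lastLo B < lastHi B
  lastLo<lastHi (box lo hi h) = proj₂ (isBox-init-last lo hi h)

  ∷ʳ-∈ᵇ : ∀ {n} (B : Box (suc n)) {x y} → x ∈ᵇ base B → lastLo B < y → y < lastHi B → (x ∷ʳ y) ∈ᵇ B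
  ∷ʳ-∈ᵇ (box lo hi _) {x} {y} (inBox x∈) l<y y<u = inBox (subst₂ (λ a b → InBox 𝓜 a b (x ∷ʳ y))
    (sym (init∷ʳlast lo)) (sym (init∷ʳlast hi)) (inBox-∷ʳ (init lo) (init hi) x x∈ l<y y<u))

  ∷ʳ-∈ᵇ⁻ : ∀ {n} (B : Box (suc n)) {x y} → (x ∷ʳ y) ∈ᵇ B → x ∈ᵇ base B × (lastLo B < y) × (y < lastHi B)
  ∷ʳ-∈ᵇ⁻ (box lo hi _) {x} {y} (inBox h) =
    let (x∈ , l<y , y<u) = inBox-∷ʳ⁻ (init lo) (init hi) x
                             (subst₂ (λ a b → InBox 𝓜 a b (x ∷ʳ y)) (init∷ʳlast lo) (init∷ʳlast hi) h)
    in inBox x∈ , l<y , y<u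

  _×ᵇ_ : ∀ {n} → Box n → ∀ {l u} → l < u → Box (suc n)
  B ×ᵇ l<u = box (lo B ∷ʳ _) (hi B ∷ʳ _) (isBox-∷ʳ (lo B) (hi B) (nonempty B) l<u)

  ×ᵇ-elim : ∀ {n} (B : Box n) {l u} (l<u : l < u) (P : Vec 𝕄 (suc n) → Set) →
            (∀ x z → x ∈ᵇ B → l < z → z < u → P (x ∷ʳ z)) → ∀ v → v ∈ᵇ B ×ᵇ l<u → P v
  ×ᵇ-elim B l<u P f v v∈ =
    let (x∈ , l<z , z<u) = inBox-∷ʳ⁻ (lo B) (hi B) (init v) (bounds (subst (_∈ᵇ B ×ᵇ l<u) (init∷ʳlast v) v∈))
    in subst P (sym (init∷ʳlast v)) (f (init v) (last v) (inBox x∈) l<z z<u)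

  centre : ∀ {n} → Box n → Vec 𝕄 n
  centre B = tabulate (λ i → proj₁ (dense (nonempty B i)))

  centre-∈ᵇ : ∀ {n} (B : Box n) → centre B ∈ᵇ B
  centre-∈ᵇ B = inBox λ i → subst (λ w → (lookup (lo B) i < w) × (w < lookup (hi B) i))
                        (sym (lookup∘tabulate (λ i → proj₁ (dense (nonempty B i))) i)) (proj₂ (dense (nonempty B i)))

  ∩ᵇ : ∀ {n} {v} (B₁ B₂ : Box n) → v ∈ᵇ B₁ → v ∈ᵇ B₂ → Σ (Box n) λ B → v ∈ᵇ B × B ⊆ᵇ B₁ × B ⊆ᵇ B₂
  ∩ᵇ {v = v} B₁ B₂ (inBox v∈₁) (inBox v∈₂) =
    box lo₁₂ hi₁₂ (λ i → <-trans (proj₁ (v∈ i)) (proj₂ (v∈ i))) , inBox v∈ ,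
    (λ {w} (inBox h) → inBox (⊆₁ {w} h)) , (λ {w} (inBox h) → inBox (⊆₂ {w} h))
    where
      lo₁₂ = zipWith _⊔_ (lo B₁) (lo B₂)
      hi₁₂ = zipWith _⊓_ (hi B₁) (hi B₂)
      v∈ : InBox 𝓜 lo₁₂ hi₁₂ v
      v∈ i = subst (_< lookup v i) (sym (lookup-zipWith _⊔_ i (lo B₁) (lo B₂)))
                   (⊔-< (proj₁ (v∈₁ i)) (proj₁ (v∈₂ i))) ,
             subst (lookup v i <_) (sym (lookup-zipWith _⊓_ i (hi B₁) (hi B₂)))
                   (<-⊓ (proj₂ (v∈₁ i)) (proj₂ (v∈₂ i)))
      meetBounds : ∀ {w} → InBox 𝓜 lo₁₂ hi₁₂ w → ∀ i →
               ((lookup (lo B₁) i < lookup w i) × (lookup (lo B₂) i < lookup w i)) ×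
               ((lookup w i < lookup (hi B₁) i) × (lookup w i < lookup (hi B₂) i))
      meetBounds {w} h i = ⊔-<⁻ (subst (_< lookup w i) (lookup-zipWith _⊔_ i (lo B₁) (lo B₂)) (proj₁ (h i))) ,
                       <-⊓⁻ (subst (lookup w i <_) (lookup-zipWith _⊓_ i (hi B₁) (hi B₂)) (proj₂ (h i)))
      ⊆₁ : ∀ {w} → InBox 𝓜 lo₁₂ hi₁₂ w → InBox 𝓜 (lo B₁) (hi B₁) w
      ⊆₁ {w} h i = let ((l , _) , (u , _)) = meetBounds {w} h i in l , u
      ⊆₂ : ∀ {w} → InBox 𝓜 lo₁₂ hi₁₂ w → InBox 𝓜 (lo B₂) (hi B₂) w
      ⊆₂ {w} h i = let ((_ , l) , (_ , u)) = meetBounds {w} h i in l , u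

module LocalOpenness (lem : ExcludedMiddle (lsuc 0ℓ)) (𝓜 : Structure) where
  open Structure 𝓜 renaming (M to 𝕄)
  open IsStrictTotalOrder isSTO using (asym) renaming (trans to <-trans)
  open Classical lem
  open StrictTotalOrderLemmas isSTO

  gapAbove : ∀ (F : List 𝕄) {a b} → a < b → ∃ λ y → (a < y) × (y < b) × (∀ f → f ∈ F → ¬ ((a < f) × (f < y)))
  gapAbove [] a<b = let (y , a<y , y<b) = dense a<b in y , a<y , y<b , λ _ ()
  gapAbove (f ∷ F) {a} a<b with gapAbove F a<b
  ... | y , a<y , y<b , gap with em {(a < f) × (f < y)}
  ...   | yes (a<f , f<y) =
          let (y′ , a<y′ , y′<f) = dense a<f in
          y′ , a<y′ , <-trans y′<f (<-trans f<y y<b) ,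
          λ { _ (here refl) (_ , f<y′) → asym f<y′ y′<f
            ; g (there g∈F) (a<g , g<y′) → gap g g∈F (a<g , <-trans g<y′ (<-trans y′<f f<y)) }
  ...   | no ¬a<f<y = y , a<y , y<b , λ { _ (here refl) → ¬a<f<y ; g (there g∈F) → gap g g∈F }

  leastInList : ∀ (F : List 𝕄) (S : Pred 𝕄 0ℓ) → (∀ z → S z → z ∈ F) → ∀ {a} → S a →
                ∃ λ m → S m × (∀ z → S z → ¬ (z < m))
  leastInList [] S S⊆F {a} Sa with S⊆F a Sa
  ... | ()
  leastInList (f ∷ F) S S⊆F {a} Sa with em {∃ λ z → S z × ¬ z ≡ f}
  ... | no ¬other =
        f , subst S (only Sa) Sa , λ z Sz z<f → <-irrefl (subst (_< f) (only Sz) z<f)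
    where
      only : ∀ {z} → S z → z ≡ f
      only {z} Sz = dne λ z≢f → ¬other (z , Sz , z≢f)
  ... | yes (a′ , Sa′ , a′≢f) with leastInList F (λ z → S z × ¬ z ≡ f) S′⊆F (Sa′ , a′≢f)
    where
      S′⊆F : ∀ z → S z × ¬ z ≡ f → z ∈ F
      S′⊆F z (Sz , z≢f) with S⊆F z Sz
      ... | here z≡f = ⊥-elim (z≢f z≡f)
      ... | there z∈F = z∈F
  ...   | m , (Sm , m≢f) , least with em {S f × (f < m)}
  ...     | yes (Sf , f<m) = f , Sf , λ z Sz z<f → case em {z ≡ f} of λ
              { (yes refl) → <-irrefl z<f ; (no z≢f) → least z (Sz , z≢f) (<-trans z<f f<m) }
  ...     | no ¬Sf×f<m = m , Sm , λ z Sz z<m → case em {z ≡ f} of λ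
              { (yes refl) → ¬Sf×f<m (Sz , z<m) ; (no z≢f) → least z (Sz , z≢f) z<m }

  Interior : Pred 𝕄 0ℓ → 𝕄 → Set
  Interior A y = ∃ λ s → ∃ λ t → (s < y) × (y < t) × (∀ z → s < z → z < t → A z)

  Interior-cong : ∀ {A A′ : Pred 𝕄 0ℓ} → (∀ y → A y ⇔ A′ y) → ∀ {y} → Interior A y → Interior A′ y
  Interior-cong A⇔A′ (s , t , s<y , y<t , A-on) = s , t , s<y , y<t , λ z s<z z<t → to (A⇔A′ z) (A-on z s<z z<t)

  AlmostOpenIn : 𝕄 → 𝕄 → Pred 𝕄 0ℓ → Set
  AlmostOpenIn l u A = ∃ λ (F : List 𝕄) → ∀ y → l < y → y < u → A y → Interior A y ⊎ y ∈ F

  AlmostOpenIn-cong : ∀ {A A′ : Pred 𝕄 0ℓ} {l u} → (∀ y → A y ⇔ A′ y) → AlmostOpenIn l u A → AlmostOpenIn l u A′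
  AlmostOpenIn-cong A⇔A′ (F , almost) = F , λ y l<y y<u A′y →
    case almost y l<y y<u (from (A⇔A′ y) A′y) of λ
      { (inj₁ interior) → inj₁ (Interior-cong A⇔A′ interior)
      ; (inj₂ y∈F) → inj₂ y∈F }

  finitePlusOpenConvex-cong : ∀ {S T : Pred 𝕄 0ℓ} → (∀ y → S y ⇔ T y) →
                              FinitePlusOpenConvex 𝓜 S → FinitePlusOpenConvex 𝓜 T
  finitePlusOpenConvex-cong S⇔T (F , k , C , C-open-convex , S⇔) =
    F , k , C , C-open-convex , λ y → mk⇔ (to (S⇔ y) ∘ from (S⇔T y)) (to (S⇔T y) ∘ from (S⇔ y))

  almostOpen : ∀ {A l u} → FinitePlusOpenConvex 𝓜 (λ y → A y × InInterval 𝓜 l u y) → AlmostOpenIn l u A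
  almostOpen (F , k , C , C-open-convex , A⇔) = F , λ y l<y y<u Ay → case to (A⇔ y) (Ay , l<y , y<u) of λ
    { (inj₁ y∈F) → inj₂ y∈F
    ; (inj₂ (i , Cy)) → let (s , t , s<y , y<t , C⊇) = proj₁ (C-open-convex i) Cy in
        inj₁ (s , t , s<y , y<t , λ z s<z z<t → proj₁ (from (A⇔ z) (inj₂ (i , C⊇ z (s<z , z<t))))) }

  ⟨_,_⟩⊆⟨_,_⟩ : 𝕄 → 𝕄 → 𝕄 → 𝕄 → Set
  ⟨ l′ , u′ ⟩⊆⟨ l , u ⟩ = (∀ {z} → l′ < z → l < z) × (∀ {z} → z < u′ → z < u)

  ⊆-trans : ∀ {l u l′ u′ l″ u″} →
            ⟨ l″ , u″ ⟩⊆⟨ l′ , u′ ⟩ → ⟨ l′ , u′ ⟩⊆⟨ l , u ⟩ → ⟨ l″ , u″ ⟩⊆⟨ l , u ⟩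
  ⊆-trans (l′≤l″ , u″≤u′) (l≤l′ , u′≤u) = l≤l′ ∘ l′≤l″ , u′≤u ∘ u″≤u′

  ⊆-⊔⊓ˡ : ∀ l l′ u u′ → ⟨ l ⊔ l′ , u ⊓ u′ ⟩⊆⟨ l , u ⟩
  ⊆-⊔⊓ˡ l l′ u u′ = proj₁ ∘ ⊔-<⁻ , proj₁ ∘ <-⊓⁻

  ⊆-⊔⊓ʳ : ∀ l l′ u u′ → ⟨ l ⊔ l′ , u ⊓ u′ ⟩⊆⟨ l′ , u′ ⟩
  ⊆-⊔⊓ʳ l l′ u u′ = proj₂ ∘ ⊔-<⁻ , proj₂ ∘ <-⊓⁻

  AlmostOpenIn-mono : ∀ {A l u l′ u′} → ⟨ l′ , u′ ⟩⊆⟨ l , u ⟩ → AlmostOpenIn l u A → AlmostOpenIn l′ u′ A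
  AlmostOpenIn-mono (l≤l′ , u′≤u) (F , almost) = F , λ y l′<y y<u′ → almost y (l≤l′ l′<y) (u′≤u y<u′)

  openJustAbove : ∀ {A a b} → AlmostOpenIn a b A → a < b →
                  ∃ λ y → (a < y) × (y < b) × (∀ y′ → a < y′ → y′ < y → A y′ → Interior A y′)
  openJustAbove (F , almost) a<b =
    let (y , a<y , y<b , gap) = gapAbove F a<b in
    y , a<y , y<b , λ y′ a<y′ y′<y Ay′ → case almost y′ a<y′ (<-trans y′<y y<b) Ay′ of λ
      { (inj₁ interior) → interior
      ; (inj₂ y′∈F) → ⊥-elim (gap y′ y′∈F (a<y′ , y′<y)) }

module Dichotomy (lem : ExcludedMiddle (lsuc 0ℓ)) (𝓜 : Structure) (U : UniformlyLocallyWeaklyOMinimal2 𝓜) where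
  open Structure 𝓜 renaming (M to 𝕄; Def to Definable)
  open IsStrictTotalOrder isSTO using (compare) renaming (trans to <-trans)
  open UniformlyLocallyWeaklyOMinimal2 U using (condB)
  open Classical lem
  open StrictTotalOrderLemmas isSTO
  open Formulas lem 𝓜
  open Boxes 𝓜
  open _∈ᵇ_
  open LocalOpenness lem 𝓜

  -- Condition (a) of the definition is not needed: a dummy coordinate reduces the case n = 0
  -- of this lemma to condition (b).
  fibres-almostOpen : ∀ {n} (Z : Pred (Vec 𝕄 (suc n)) 0ℓ) → Definable (suc n) Z → ∀ a (b : Vec 𝕄 n) →
    ∃ λ l → ∃ λ u → (l < a) × (a < u) ×
      Σ (Box n) λ B → b ∈ᵇ B × (∀ x → x ∈ᵇ B → AlmostOpenIn l u (Fibre 𝓜 Z x))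
  fibres-almostOpen {n} Z dZ a b =
    let (l , u , lo , hi , l<a , a<u , b∷a∈ , tame) = condB n ⟦ φ ⟧ˢ (definable-formula φ) a (b ∷ʳ a)
        B = box lo hi (λ i → <-trans (proj₁ (b∷a∈ i)) (proj₂ (b∷a∈ i)))
        (b∈ , lo<a , a<hi) = ∷ʳ-∈ᵇ⁻ B (inBox b∷a∈)
    in l , u , l<a , a<u , base B , b∈ , λ x x∈ →
         almostOpen (finitePlusOpenConvex-cong
           (λ y → mk⇔ (map₁ (⟦⟧ˢ-elim φ {x} {ε ▷ a ▷ y})) (map₁ (⟦⟧ˢ-intro φ {x} {ε ▷ a ▷ y})))
           (tame (x ∷ʳ a) (bounds (∷ʳ-∈ᵇ B x∈ lo<a a<hi))))
    where
      φ : Formula n 2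
      φ = rel Z dZ (ε ▷ # 0)

  DownwardClosedAbove : ∀ {n} → 𝕄 → Pred (Vec 𝕄 (suc n)) 0ℓ → Set
  DownwardClosedAbove c Q = ∀ x {y y′} → c < y → y < y′ → Q (x ∷ʳ y′) → Q (x ∷ʳ y)

  Dichotomy : ℕ → Set₁
  Dichotomy n = ∀ (Z : Pred (Vec 𝕄 n) 0ℓ) → Definable n Z → ∀ (B : Box n) → SubBox B Z ⊎ SubBox B (∁ Z)

  UniformWitness : ℕ → Set₁
  UniformWitness n = ∀ (Q : Pred (Vec 𝕄 (suc n)) 0ℓ) → Definable (suc n) Q → ∀ {c d} (B : Box n) →
    DownwardClosedAbove c Q → (∀ x → x ∈ᵇ B → ∃ λ y → (c < y) × (y < d) × Q (x ∷ʳ y)) →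
    ∃ λ y → (c < y) × (y < d) × SubBox B (λ x → Q (x ∷ʳ y))

  dichotomy₀ : Dichotomy 0
  dichotomy₀ Z _ B with em {Z []}
  ... | yes Z[] = inj₁ (B , ⊆ᵇ-refl , λ { [] _ → Z[] })
  ... | no ¬Z[] = inj₂ (B , ⊆ᵇ-refl , λ { [] _ → ¬Z[] })

  uniformWitness₀ : UniformWitness 0
  uniformWitness₀ Q _ B _ cover =
    let (y , c<y , y<d , Q[y]) = cover [] (inBox λ ()) in y , c<y , y<d , B , ⊆ᵇ-refl , λ { [] _ → Q[y] }

  uniformInterval : ∀ {n} → UniformWitness n → ∀ (W : Pred (Vec 𝕄 (suc n)) 0ℓ) → Definable (suc n) W →
    ∀ (B : Box n) k₀ → (∀ x → x ∈ᵇ B → Interior (Fibre 𝓜 W x) k₀) →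
    ∃ λ t → (k₀ < t) × SubBox B (λ x → ∀ z → k₀ < z → z < t → W (x ∷ʳ z))
  uniformInterval {n} uniformWitness W dW B k₀ k₀-interior =
    let (t , k₀<t , _ , B′ , B′⊆B , onB′) = uniformWitness ⟦ φ ⟧ˢ (definable-formula φ) B downward cover
    in t , k₀<t , B′ , B′⊆B , λ x x∈ → ⟦⟧ˢ-elim φ {x} {ε ▷ t} (onB′ x x∈)
    where
      φ : Formula n 1
      φ = ∀⟨ cst k₀ , var (# 0) ⟩ rel W dW (ε ▷ # 0)
      downward : DownwardClosedAbove k₀ ⟦ φ ⟧ˢ
      downward x {y} {y′} _ y<y′ φy′ =
        ⟦⟧ˢ-intro φ {x} {ε ▷ y} λ z k₀<z z<y → ⟦⟧ˢ-elim φ {x} {ε ▷ y′} φy′ z k₀<z (<-trans z<y y<y′)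
      d : 𝕄
      d = proj₁ (noRightEnd k₀)
      cover : ∀ x → x ∈ᵇ B → ∃ λ y → (k₀ < y) × (y < d) × ⟦ φ ⟧ˢ (x ∷ʳ y)
      cover x x∈ =
        let (s , t , s<k₀ , k₀<t , W-on) = k₀-interior x x∈
            (y , k₀<y , y<t⊓d) = dense (<-⊓ k₀<t (proj₂ (noRightEnd k₀)))
            (y<t , y<d) = <-⊓⁻ y<t⊓d
        in y , k₀<y , y<d , ⟦⟧ˢ-intro φ {x} {ε ▷ y} λ z k₀<z z<y → W-on z (<-trans s<k₀ k₀<z) (<-trans z<y y<t)

  stack : ∀ {n} (B : Box (suc n)) {B′ : Box n} {W : Pred (Vec 𝕄 (suc n)) 0ℓ} {k₀} →
          B′ ⊆ᵇ base B → lastLo B < k₀ → k₀ < lastHi B →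
          (∃ λ t → (k₀ < t) × SubBox B′ (λ x → ∀ z → k₀ < z → z < t → W (x ∷ʳ z))) → SubBox B W
  stack B B′⊆ lo<k₀ k₀<hi (t , k₀<t , B″ , B″⊆B′ , onB″) =
    B″ ×ᵇ k₀<t⊓hi ,
    (λ {v} v∈ → ×ᵇ-elim B″ k₀<t⊓hi (_∈ᵇ B)
       (λ x z x∈ k₀<z z<t⊓hi →
          ∷ʳ-∈ᵇ B (B′⊆ (B″⊆B′ x∈)) (<-trans lo<k₀ k₀<z) (proj₂ (<-⊓⁻ z<t⊓hi))) v v∈) ,
    ×ᵇ-elim B″ k₀<t⊓hi _ (λ x z x∈ k₀<z z<t⊓hi → onB″ x x∈ z k₀<z (proj₁ (<-⊓⁻ z<t⊓hi)))
    where
      k₀<t⊓hi = <-⊓ k₀<t k₀<hi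

  dichotomy-fromInteriorPoint : ∀ {n} → Dichotomy n → UniformWitness n →
    ∀ (Z : Pred (Vec 𝕄 (suc n)) 0ℓ) → Definable (suc n) Z →
    ∀ (B : Box (suc n)) (B′ : Box n) → B′ ⊆ᵇ base B →
    ∀ {y} → lastLo B < y → y < lastHi B →
    (∀ x → x ∈ᵇ B′ → Interior (Fibre 𝓜 Z x) y ⊎ Interior (Fibre 𝓜 (∁ Z) x) y) →
    SubBox B Z ⊎ SubBox B (∁ Z)
  dichotomy-fromInteriorPoint {n} dichotomy uniformWitness Z dZ B B′ B′⊆ {y} lo<y y<hi interiorPoint =
    stackEither (dichotomy ⟦ φ ⟧ˢ (definable-formula φ) B′)
    where
      φ : Formula n 0
      φ = interiorᶠ (cst y) (rel Z dZ (ε ▷ # 0))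
      stackEither : SubBox B′ ⟦ φ ⟧ˢ ⊎ SubBox B′ (∁ ⟦ φ ⟧ˢ) → SubBox B Z ⊎ SubBox B (∁ Z)
      stackEither (inj₁ (B″ , B″⊆B′ , onB″)) = inj₁ (stack B (B′⊆ ∘ B″⊆B′) lo<y y<hi
        (uniformInterval uniformWitness Z dZ B″ y λ x x∈ → ⟦⟧ˢ-elim φ {x} {ε} (onB″ x x∈)))
      stackEither (inj₂ (B″ , B″⊆B′ , onB″)) = inj₂ (stack B (B′⊆ ∘ B″⊆B′) lo<y y<hi
        (uniformInterval uniformWitness (∁ Z) (def-compl dZ) B″ y λ x x∈ → case interiorPoint x (B″⊆B′ x∈) of λ
          { (inj₁ inZ) → ⊥-elim (onB″ x x∈ (⟦⟧ˢ-intro φ {x} {ε} inZ))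
          ; (inj₂ in∁Z) → in∁Z }))

  dichotomy-fromAlmostOpen : ∀ {n} → Dichotomy n → UniformWitness n →
    ∀ (Z : Pred (Vec 𝕄 (suc n)) 0ℓ) → Definable (suc n) Z →
    ∀ (B : Box (suc n)) (B₀ : Box n) → B₀ ⊆ᵇ base B →
    ∀ {l₀ u₀} → ⟨ l₀ , u₀ ⟩⊆⟨ lastLo B , lastHi B ⟩ → l₀ < u₀ →
    (∀ x → x ∈ᵇ B₀ → AlmostOpenIn l₀ u₀ (Fibre 𝓜 Z x) × AlmostOpenIn l₀ u₀ (Fibre 𝓜 (∁ Z) x)) →
    SubBox B Z ⊎ SubBox B (∁ Z)
  dichotomy-fromAlmostOpen {n} dichotomy uniformWitness Z dZ B B₀ B₀⊆ {l₀} {u₀} (lo≤l₀ , u₀≤hi) l₀<u₀ almostOpen =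
    let (y₁ , l₀<y₁ , y₁<u₀ , B′ , B′⊆B₀ , onB′) = uniformWitness ⟦ φ ⟧ˢ (definable-formula φ) B₀ downward cover
        (y , l₀<y , y<y₁) = dense l₀<y₁
    in dichotomy-fromInteriorPoint dichotomy uniformWitness Z dZ B B′ (B₀⊆ ∘ B′⊆B₀)
         (lo≤l₀ l₀<y) (u₀≤hi (<-trans y<y₁ y₁<u₀)) λ x x∈ → ⟦⟧ˢ-elim φ {x} {ε ▷ y₁} (onB′ x x∈) y l₀<y y<y₁
    where
      -- every point of (l₀ , y) is interior to Z_x or to its complement
      φ : Formula n 1
      φ = ∀⟨ cst l₀ , var (# 0) ⟩ (interiorᶠ (var (# 0)) (rel Z dZ (ε ▷ # 0))
                                  ∨ᶠ interiorᶠ (var (# 0)) (¬ᶠ rel Z dZ (ε ▷ # 0)))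
      downward : DownwardClosedAbove l₀ ⟦ φ ⟧ˢ
      downward x {y} {y′} _ y<y′ φy′ =
        ⟦⟧ˢ-intro φ {x} {ε ▷ y} λ z l₀<z z<y → ⟦⟧ˢ-elim φ {x} {ε ▷ y′} φy′ z l₀<z (<-trans z<y y<y′)
      cover : ∀ x → x ∈ᵇ B₀ → ∃ λ y → (l₀ < y) × (y < u₀) × ⟦ φ ⟧ˢ (x ∷ʳ y)
      cover x x∈ =
        let (Z-almostOpen , ∁Z-almostOpen) = almostOpen x x∈
            (y₁ , l₀<y₁ , y₁<u₀ , Z-open) = openJustAbove Z-almostOpen l₀<u₀
            (y , l₀<y , y<y₁ , ∁Z-open) =
              openJustAbove (AlmostOpenIn-mono (id , λ z<y₁ → <-trans z<y₁ y₁<u₀) ∁Z-almostOpen) l₀<y₁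
        in y , l₀<y , <-trans y<y₁ y₁<u₀ , ⟦⟧ˢ-intro φ {x} {ε ▷ y} λ y′ l₀<y′ y′<y →
             case em {Z (x ∷ʳ y′)} of λ
             { (yes Zy′) → inj₁ (Z-open y′ l₀<y′ (<-trans y′<y y<y₁) Zy′)
             ; (no ¬Zy′) → inj₂ (∁Z-open y′ l₀<y′ y′<y ¬Zy′) }

  dichotomy-step : ∀ {n} → Dichotomy n → UniformWitness n → Dichotomy (suc n)
  dichotomy-step dichotomy uniformWitness Z dZ B =
    let (a , lo<a , a<hi) = dense (lastLo<lastHi B)
        b = centre (base B)
        (l₁ , u₁ , l₁<a , a<u₁ , B₁ , b∈B₁ , Z-almostOpen) = fibres-almostOpen Z dZ a b
        (l₂ , u₂ , l₂<a , a<u₂ , B₂ , b∈B₂ , ∁Z-almostOpen) = fibres-almostOpen (∁ Z) (def-compl dZ) a b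
        (B₁₂ , b∈B₁₂ , B₁₂⊆B₁ , B₁₂⊆B₂) = ∩ᵇ B₁ B₂ b∈B₁ b∈B₂
        (B₀ , _ , B₀⊆B , B₀⊆B₁₂) = ∩ᵇ (base B) B₁₂ (centre-∈ᵇ (base B)) b∈B₁₂
        ⊆l₁₂ = ⊆-⊔⊓ʳ (lastLo B) (l₁ ⊔ l₂) (lastHi B) (u₁ ⊓ u₂)
    in dichotomy-fromAlmostOpen dichotomy uniformWitness Z dZ B B₀ B₀⊆B
         (⊆-⊔⊓ˡ (lastLo B) (l₁ ⊔ l₂) (lastHi B) (u₁ ⊓ u₂))
         (<-trans (⊔-< lo<a (⊔-< l₁<a l₂<a)) (<-⊓ a<hi (<-⊓ a<u₁ a<u₂)))
         λ x x∈ → AlmostOpenIn-mono (⊆-trans ⊆l₁₂ (⊆-⊔⊓ˡ l₁ l₂ u₁ u₂)) (Z-almostOpen x (B₁₂⊆B₁ (B₀⊆B₁₂ x∈))) ,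
                  AlmostOpenIn-mono (⊆-trans ⊆l₁₂ (⊆-⊔⊓ʳ l₁ l₂ u₁ u₂)) (∁Z-almostOpen x (B₁₂⊆B₂ (B₀⊆B₁₂ x∈)))

  WitnessedAround : ∀ {m} → 𝕄 → 𝕄 → Pred (Vec 𝕄 (suc (suc m))) 0ℓ → Vec 𝕄 m → 𝕄 → Set
  WitnessedAround c d Q x k = ∃ λ y → (c < y) × (y < d) × Interior (λ k′ → Q ((x ∷ʳ k′) ∷ʳ y)) k

  -- If y < y′, downward closure would put v into the fibre of y, below its first point z.
  firstPoints-uniform : ∀ {m} {Q : Pred (Vec 𝕄 (suc (suc m))) 0ℓ} {c} → DownwardClosedAbove c Q →
    ∀ (x : Vec 𝕄 m) {a v t y′} → a < v → c < y′ → Q ((x ∷ʳ v) ∷ʳ y′) →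
    (∀ z → v < z → z < t →
       ∃ λ y → (c < y) × Q ((x ∷ʳ z) ∷ʳ y) × (∀ k → a < k → k < z → ¬ Q ((x ∷ʳ k) ∷ʳ y))) →
    ∀ z → v < z → z < t → Q ((x ∷ʳ z) ∷ʳ y′)
  firstPoints-uniform down x {v = v} {y′ = y′} a<v c<y′ Qvy′ first z v<z z<t with first z v<z z<t
  ... | y , c<y , Qzy , noneBelow with compare y′ y
  ...   | tri< y′<y _ _ = down (x ∷ʳ z) c<y′ y′<y Qzy
  ...   | tri≈ _ refl _ = Qzy
  ...   | tri> _ _ y<y′ = ⊥-elim (noneBelow v a<v v<z (down (x ∷ʳ v) c<y y<y′ Qvy′))

  module LineArgument {m} (Q : Pred (Vec 𝕄 (suc (suc m))) 0ℓ) (dQ : Definable (suc (suc m)) Q) {c d}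
                      (down : DownwardClosedAbove c Q) (x : Vec 𝕄 m) {p q} (p<q : p < q)
                      (cover : ∀ k → p < k → k < q → ∃ λ y → (c < y) × (y < d) × Q ((x ∷ʳ k) ∷ʳ y))
                      (none : ¬ (∃ λ k → (p < k) × (k < q) × WitnessedAround c d Q x k)) where

    Qₓ : 𝕄 → 𝕄 → Set
    Qₓ k y = Q ((x ∷ʳ k) ∷ʳ y)

    x₀ : 𝕄
    x₀ = proj₁ (dense p<q)

    p<x₀ : p < x₀
    p<x₀ = proj₁ (proj₂ (dense p<q))

    x₀<q : x₀ < q
    x₀<q = proj₂ (proj₂ (dense p<q))

    module NearX₀ (l₁ u₁ : 𝕄) (l₁<x₀ : l₁ < x₀) (x₀<u₁ : x₀ < u₁)
                  (e : 𝕄) (c<e : c < e) (e≤d : ∀ {y} → y < e → y < d)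
                  (fibre-almostOpen : ∀ y → c < y → y < e → AlmostOpenIn l₁ u₁ (λ k → Qₓ k y)) where

      pl pu : 𝕄
      pl = p ⊔ l₁
      pu = q ⊓ u₁

      x₀<pu : x₀ < pu
      x₀<pu = <-⊓ x₀<q x₀<u₁

      pl<x₀ : pl < x₀
      pl<x₀ = ⊔-< p<x₀ l₁<x₀

      fibre-finite : ∀ y → c < y → y < e → ∃ λ F → ∀ k → pl < k → k < pu → Qₓ k y → k ∈ F
      fibre-finite y c<y y<e =
        let (F , almost) = fibre-almostOpen y c<y y<e in
        F , λ k pl<k k<pu Qky → case almost k (proj₂ (⊔-<⁻ pl<k)) (proj₂ (<-⊓⁻ k<pu)) Qky of λ
          { (inj₁ interior) →
              ⊥-elim (none (k , proj₁ (⊔-<⁻ pl<k) , proj₁ (<-⊓⁻ k<pu) , y , c<y , e≤d y<e , interior))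
          ; (inj₂ k∈F) → k∈F }

      witness-below-e : ∀ k → pl < k → k < pu → ∃ λ y → (c < y) × (y < e) × Qₓ k y
      witness-below-e k pl<k k<pu =
        let (y₀ , c<y₀ , _ , Qky₀) = cover k (proj₁ (⊔-<⁻ pl<k)) (proj₁ (<-⊓⁻ k<pu))
            (y , c<y , y<y₀⊓e) = dense (<-⊓ c<y₀ c<e)
        in y , c<y , proj₂ (<-⊓⁻ y<y₀⊓e) , down (x ∷ʳ k) c<y (proj₁ (<-⊓⁻ y<y₀⊓e)) Qky₀

      FirstPoint : 𝕄 → Set
      FirstPoint k = (x₀ < k) × (k < pu) ×
                     ∃ λ y → (c < y) × (y < e) × Qₓ k y × (∀ z → x₀ < z → z < k → ¬ Qₓ z y)

      firstPoint-below : ∀ k → x₀ < k → k < pu → ∃ λ v → FirstPoint v × ¬ (k < v)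
      firstPoint-below k x₀<k k<pu =
        let (y , c<y , y<e , Qky) = witness-below-e k (<-trans pl<x₀ x₀<k) k<pu
            (F , finite) = fibre-finite y c<y y<e
            S = λ z → (x₀ < z) × ¬ (k < z) × Qₓ z y
            (v , (x₀<v , v≤k , Qvy) , least) =
              leastInList F S (λ z (x₀<z , z≤k , Qzy) → finite z (<-trans pl<x₀ x₀<z) (≮-<-trans z≤k k<pu) Qzy)
                          (x₀<k , <-irrefl , Qky)
        in v , (x₀<v , ≮-<-trans v≤k k<pu , y , c<y , y<e , Qvy ,
                λ z x₀<z z<v Qzy → least z (x₀<z , (λ k<z → v≤k (<-trans k<z z<v)) , Qzy) z<v) , v≤k

      φ : Formula m 1
      φ = cst x₀ <ᶠ var (# 0) ∧ᶠ var (# 0) <ᶠ cst pu ∧ᶠ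
          (∃⟨ cst c , cst e ⟩ (rel Q dQ (ε ▷ # 1 ▷ # 0) ∧ᶠ
                               (∀⟨ cst x₀ , var (# 1) ⟩ ¬ᶠ rel Q dQ (ε ▷ # 0 ▷ # 1))))

      φ⇔FirstPoint : ∀ k → ⟦ φ ⟧ˢ (x ∷ʳ k) ⇔ FirstPoint k
      φ⇔FirstPoint k = mk⇔ (⟦⟧ˢ-elim φ {x} {ε ▷ k}) (⟦⟧ˢ-intro φ {x} {ε ▷ k})

      -- If the first point v of the fibre of y′ is interior to the set of first points, then
      -- that fibre contains an interval above v.
      interiorFirstPoint-absurd : ∀ {v} → FirstPoint v → Interior FirstPoint v → ⊥
      interiorFirstPoint-absurd {v} (x₀<v , _ , y′ , c<y′ , y′<e , Qvy′ , _) (s , t , s<v , v<t , first) =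
        none (k , <-trans p<x₀ x₀<k , proj₁ (<-⊓⁻ k<pu) , y′ , c<y′ , e≤d y′<e , v , t , v<k , k<t , uniform)
        where
          k = proj₁ (dense v<t)
          v<k = proj₁ (proj₂ (dense v<t))
          k<t = proj₂ (proj₂ (dense v<t))
          x₀<k = proj₁ (first k (<-trans s<v v<k) k<t)
          k<pu = proj₁ (proj₂ (first k (<-trans s<v v<k) k<t))
          uniform : ∀ z → v < z → z < t → Qₓ z y′
          uniform = firstPoints-uniform {Q = Q} down x x₀<v c<y′ Qvy′ λ z v<z z<t →
            let (_ , _ , y , c<y , _ , Qzy , noneBelow) = first z (<-trans s<v v<z) z<t in y , c<y , Qzy , noneBelow

      absurd : ⊥
      absurd =
        let (_ , u₃ , l₃<x₀ , x₀<u₃ , B₃ , x∈B₃ , almostOpen₃) =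
              fibres-almostOpen ⟦ φ ⟧ˢ (definable-formula φ) x₀ x
            firstPoints-almostOpen : AlmostOpenIn x₀ (u₃ ⊓ pu) FirstPoint
            firstPoints-almostOpen = AlmostOpenIn-cong φ⇔FirstPoint (AlmostOpenIn-mono
                              ((λ x₀<z → <-trans l₃<x₀ x₀<z) , proj₁ ∘ <-⊓⁻) (almostOpen₃ x x∈B₃))
            (e₀ , x₀<e₀ , e₀<u₃⊓pu , interiorAbove) = openJustAbove firstPoints-almostOpen (<-⊓ x₀<u₃ x₀<pu)
            (e′ , x₀<e′ , e′<e₀) = dense x₀<e₀
            (v , Fv , v≤e′) = firstPoint-below e′ x₀<e′ (<-trans e′<e₀ (proj₂ (<-⊓⁻ e₀<u₃⊓pu)))
        in interiorFirstPoint-absurd Fv (interiorAbove v (proj₁ Fv) (≮-<-trans v≤e′ e′<e₀) Fv)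

    c<d : c < d
    c<d = let (_ , c<y , y<d , _) = cover x₀ p<x₀ x₀<q in <-trans c<y y<d

    swap : Formula m 2
    swap = rel Q dQ (ε ▷ # 0 ▷ # 1)

    absurd : ⊥
    absurd =
      let (l₁ , u₁ , l₁<x₀ , x₀<u₁ , B₁ , x∷c∈B₁ , almostOpen₁) =
            fibres-almostOpen ⟦ swap ⟧ˢ (definable-formula swap) x₀ (x ∷ʳ c)
          (x∈ , lo<c , c<hi) = ∷ʳ-∈ᵇ⁻ B₁ x∷c∈B₁
      in NearX₀.absurd l₁ u₁ l₁<x₀ x₀<u₁ (lastHi B₁ ⊓ d) (<-⊓ c<hi c<d) (proj₂ ∘ <-⊓⁻) λ y c<y y<e →
           AlmostOpenIn-cong (λ k → mk⇔ (⟦⟧ˢ-elim swap {x} {ε ▷ y ▷ k}) (⟦⟧ˢ-intro swap {x} {ε ▷ y ▷ k}))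
             (almostOpen₁ (x ∷ʳ y) (∷ʳ-∈ᵇ B₁ x∈ (<-trans lo<c c<y) (proj₁ (<-⊓⁻ y<e))))

  uniformWitness-line : ∀ {m} (Q : Pred (Vec 𝕄 (suc (suc m))) 0ℓ) → Definable (suc (suc m)) Q → ∀ {c d} →
    DownwardClosedAbove c Q → ∀ (x : Vec 𝕄 m) {p q} → p < q →
    (∀ k → p < k → k < q → ∃ λ y → (c < y) × (y < d) × Q ((x ∷ʳ k) ∷ʳ y)) →
    ∃ λ k → (p < k) × (k < q) × WitnessedAround c d Q x k
  uniformWitness-line Q dQ down x p<q cover = dne (LineArgument.absurd Q dQ down x p<q cover)

  uniformWitness-around : ∀ {n} → UniformWitness n →
    ∀ (Q : Pred (Vec 𝕄 (suc (suc n))) 0ℓ) → Definable (suc (suc n)) Q →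
    ∀ {c d} → DownwardClosedAbove c Q → ∀ (B : Box n) k₀ → (∀ x → x ∈ᵇ B → WitnessedAround c d Q x k₀) →
    ∃ λ y → (c < y) × (y < d) ×
      ∃ λ t → (k₀ < t) × SubBox B (λ x → ∀ z → k₀ < z → z < t → Q ((x ∷ʳ z) ∷ʳ y))
  uniformWitness-around {n} uniformWitness Q dQ {c} {d} down B k₀ witnessed =
    let (y , c<y , y<d , B′ , B′⊆B , onB′) = uniformWitness ⟦ φ ⟧ˢ (definable-formula φ) B downward cover
        (t , k₀<t , uniform) = uniformInterval uniformWitness (λ v → Q (v ∷ʳ y)) (definable-section dQ y) B′ k₀
                                 λ x x∈ → ⟦⟧ˢ-elim φ {x} {ε ▷ y} (onB′ x x∈)
    in y , c<y , y<d , t , k₀<t , SubBox-⊆ B′⊆B uniform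
    where
      φ : Formula n 1
      φ = interiorᶠ (cst k₀) (rel Q dQ (ε ▷ # 0 ▷ # 3))
      downward : DownwardClosedAbove c ⟦ φ ⟧ˢ
      downward x {y} {y′} c<y y<y′ φy′ =
        let (s , t , s<k₀ , k₀<t , Q-on) = ⟦⟧ˢ-elim φ {x} {ε ▷ y′} φy′ in
        ⟦⟧ˢ-intro φ {x} {ε ▷ y} (s , t , s<k₀ , k₀<t , λ z s<z z<t → down (x ∷ʳ z) c<y y<y′ (Q-on z s<z z<t))
      cover : ∀ x → x ∈ᵇ B → ∃ λ y → (c < y) × (y < d) × ⟦ φ ⟧ˢ (x ∷ʳ y)
      cover x x∈ = let (y , c<y , y<d , around) = witnessed x x∈ in y , c<y , y<d , ⟦⟧ˢ-intro φ {x} {ε ▷ y} around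

  uniformWitness-step : ∀ {n} → Dichotomy (suc n) → UniformWitness n → UniformWitness (suc n)
  uniformWitness-step {n} dichotomy uniformWitness Q dQ {c} {d} B down cover =
    fromDichotomy (dichotomy ⟦ φ ⟧ˢ (definable-formula φ) B)
    where
      φ : Formula n 1
      φ = ∃⟨ cst c , cst d ⟩ interiorᶠ (var (# 1)) (rel Q dQ (ε ▷ # 0 ▷ # 3))
      fromDichotomy : SubBox B ⟦ φ ⟧ˢ ⊎ SubBox B (∁ ⟦ φ ⟧ˢ) →
                      ∃ λ y → (c < y) × (y < d) × SubBox B (λ x → Q (x ∷ʳ y))
      fromDichotomy (inj₁ (B′ , B′⊆B , onB′)) =
        let (k₀ , lo<k₀ , k₀<hi) = dense (lastLo<lastHi B′)
            (y , c<y , y<d , uniform) = uniformWitness-around uniformWitness Q dQ down (base B′) k₀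
              λ x x∈ → ⟦⟧ˢ-elim φ {x} {ε ▷ k₀} (onB′ (x ∷ʳ k₀) (∷ʳ-∈ᵇ B′ x∈ lo<k₀ k₀<hi))
        in y , c<y , y<d , SubBox-⊆ B′⊆B (stack B′ ⊆ᵇ-refl lo<k₀ k₀<hi uniform)
      fromDichotomy (inj₂ (B′ , B′⊆B , onB′)) =
        let x = centre (base B′)
            x∷ʳ-∈ : ∀ {k} → lastLo B′ < k → k < lastHi B′ → (x ∷ʳ k) ∈ᵇ B′
            x∷ʳ-∈ = ∷ʳ-∈ᵇ B′ (centre-∈ᵇ (base B′))
            (k , lo<k , k<hi , witnessed) = uniformWitness-line Q dQ down x (lastLo<lastHi B′)
              λ k lo<k k<hi → cover (x ∷ʳ k) (B′⊆B (x∷ʳ-∈ lo<k k<hi))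
        in ⊥-elim (onB′ (x ∷ʳ k) (x∷ʳ-∈ lo<k k<hi) (⟦⟧ˢ-intro φ {x} {ε ▷ k} witnessed))

  dichotomy×uniformWitness : ∀ n → Dichotomy n × UniformWitness n
  dichotomy×uniformWitness zero = dichotomy₀ , uniformWitness₀
  dichotomy×uniformWitness (suc n) =
    let (dichotomy , uniformWitness) = dichotomy×uniformWitness n
        dichotomy′ = dichotomy-step dichotomy uniformWitness
    in dichotomy′ , uniformWitness-step dichotomy′ uniformWitness

  dichotomy : ∀ n → Dichotomy n
  dichotomy n = proj₁ (dichotomy×uniformWitness n)

open Boxes using (interior⇒box; SubBox⇒interior; SubBox-map)
open Dichotomy using (dichotomy)

theorem3p9 : ExcludedMiddle (Level.suc 0ℓ) →
    (𝓜 : Structure) → UniformlyLocallyWeaklyOMinimal2 𝓜 →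
    (n : ℕ) (X X₁ X₂ : Pred (Vec (M 𝓜) n) 0ℓ) →
    Def 𝓜 n X → Def 𝓜 n X₁ → Def 𝓜 n X₂ →
    HasNonemptyInterior 𝓜 X →
    (∀ v → X v ⇔ (X₁ v ⊎ X₂ v)) →
    (∀ v → ¬ (X₁ v × X₂ v)) →
    HasNonemptyInterior 𝓜 X₁ ⊎ HasNonemptyInterior 𝓜 X₂
theorem3p9 lem 𝓜 U n X X₁ X₂ _ dX₁ _ X° X⇔X₁⊎X₂ _ with interior⇒box 𝓜 X°
... | B , X-on = map-⊎ (SubBox⇒interior 𝓜) (SubBox⇒interior 𝓜 ∘ SubBox-map 𝓜 λ v v∈ ¬X₁v →
                   [ ⊥-elim ∘ ¬X₁v , id ]′ (to (X⇔X₁⊎X₂ v) (X-on v v∈)))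
                 (dichotomy lem 𝓜 U n X₁ dX₁ B)
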